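{- Let $\Gamma=(\pi,\mathcal{C},\Sigma)$ be a concrete data type definition, $\mathcal{E}$ a finite set of equations between terms of sort $\pi$ (possibly with variables), and $f:\mathcal{T}_\pi\to\mathcal{T}_\pi$ a valid normalization function for $(\Gamma,\mathcal{E})$. Define the family $(f_C)_{C\in\mathcal{C}}$ by $f_C(t_1,\ldots,t_n)=f(C(t_1,\ldots,t_n))$ for every $C:\sigma_1\ldots\sigma_n\pi$ and $t_i\in\mathcal{T}_{\sigma_i}$. Then this family of construction functions is valid with respect to $\mathcal{E}$.
   Context: Fix a set $\mathcal{S}_0$ of primitive sorts and a set $\mathcal{C}_0$ of primitive constants, each having a sort in $\mathcal{S}_0$. A concrete data type definition is a triple $\Gamma=(\pi,\mathcal{C},\Sigma)$ where $\pi\notin\mathcal{S}_0$ is a sort, $\mathcal{C}$ is a non-empty set of constructor symbols, and $\Sigma$ assigns to every $C\in\mathcal{C}$ a sequence $\sigma_1\ldots\sigma_n\pi$ ($n\ge0$, each $\sigma_i\in\mathcal{S}_0\cup\{\pi\}$), written $C:\sigma_1\ldots\sigma_n\pi$. $\mathcal{T}_\sigma$ is the set of variable-free well-sorted terms of sort $\sigma$ over $\mathcal{C}_0\cup\mathcal{C}$. $=_\mathcal{E}$ is the smallest congruence on terms containing $\mathcal{E}$ (closed under substitution instances, contexts, reflexivity, symmetry, transitivity). A map $f:\mathcal{T}_\pi\to\mathcal{T}_\pi$ is a valid normalization function for $(\Gamma,\mathcal{E})$ if $f(t)=_\mathcal{E}t$ for all $t\in\mathcal{T}_\pi$ and $f(t)=f(u)$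 whenever $t=_\mathcal{E}u$. For a family of construction functions $\mathcal{F}=(f_C)_{C\in\mathcal{C}}$ (with $f_C:\mathcal{T}_{\sigma_1}\times\cdots\times\mathcal{T}_{\sigma_n}\to\mathcal{T}_\pi$), values are: $\mathrm{Val}(\sigma)=\mathcal{T}_\sigma$ for $\sigma\in\mathcal{S}_0$, and $\mathrm{Val}(\pi)$ is the smallest set containing $f_C(v_1,\ldots,v_n)$ for all $C:\sigma_1\ldots\sigma_n\pi$ and $v_i\in\mathrm{Val}(\sigma_i)$. $\mathcal{F}$ is valid with respect to $\mathcal{E}$ if (correctness) for all $C:\sigma_1\ldots\sigma_n\pi$ and $v_i\in\mathrm{Val}(\sigma_i)$, $f_C(v_1,\ldots,v_n)=_\mathcal{E}C(v_1,\ldots,v_n)$; and (completeness) for all $C:\sigma_1\ldots\sigma_n\pi$, $v_i\in\mathrm{Val}(\sigma_i)$, $D:\tau_1\ldots\tau_p\pi$, $w_j\in\mathrm{Val}(\tau_j)$, if $C(v_1,\ldots,v_n)=_\mathcal{E}D(w_1,\ldots,w_p)$ then $f_C(v_1,\ldots,v_n)=f_D(w_1,\ldots,w_p)$. -}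

module Defs where

open import Data.Nat using (ℕ)
open import Data.Empty using (⊥; ⊥-elim)
open import Data.List using (List; []; _∷_)
open import Data.List.Membership.Propositional using (_∈_)
open import Relation.Binary.PropositionalEquality using (_≡_)

data Sort (S0 : Set) : Set where
  prim : S0 → Sort S0
  π    : Sort S0

-- A concrete data type definition Γ = (π, C, Σ) together with the fixed
-- primitive sorts S0 and primitive constants C0 (each with a primitive sort).
record DataType : Set₁ where
  field
    S0       : Set
    C0       : Set
    sortOf   : C0 → S0
    Con      : Set
    -- Σ(C) = σ₁ … σₙ π  is recorded as the list of argument sorts σ₁ … σₙ
    arity    : Con → List (Sort S0)
    nonEmpty : Con

module _ (Γ : DataType) where
  open DataType Γ

  mutual
    data Term (V : Sort S0 → Set) : Sort S0 → Set where
      var   : ∀ {σ} → V σ → Term V σ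
      const : (c : C0) → Term V (prim (sortOf c))
      app   : (C : Con) → Args V (arity C) → Term V π

    data Args (V : Sort S0 → Set) : List (Sort S0) → Set where
      []  : Args V []
      _∷_ : ∀ {σ σs} → Term V σ → Args V σs → Args V (σ ∷ σs)

  mutual
    subst : ∀ {V W} → (∀ {σ} → V σ → Term W σ) → ∀ {σ} → Term V σ → Term W σ
    subst s (var x)     = s x
    subst s (const c)   = const c
    subst s (app C ts)  = app C (substArgs s ts)

    substArgs : ∀ {V W} → (∀ {σ} → V σ → Term W σ) → ∀ {σs} → Args V σs → Args W σs
    substArgs s []       = []
    substArgs s (t ∷ ts) = subst s t ∷ substArgs s ts

  Vars : Sort S0 → Set
  Vars _ = ℕ

  OTerm : Sort S0 → Set
  OTerm = Term Vars

  NoVars : Sort S0 → Set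
  NoVars _ = ⊥

  GTerm : Sort S0 → Set
  GTerm = Term NoVars

  GArgs : List (Sort S0) → Set
  GArgs = Args NoVars

  embed : ∀ {σ} → GTerm σ → OTerm σ
  embed = subst (λ ())

  embedArgs : ∀ {σs} → GArgs σs → Args Vars σs
  embedArgs = substArgs (λ ())

  record Equation : Set where
    constructor _≐_
    field
      lhs : OTerm π
      rhs : OTerm π

  mutual
    data _⊢_≈_ (E : List Equation) : ∀ {σ} → OTerm σ → OTerm σ → Set where
      axiom  : ∀ {l r} → (l ≐ r) ∈ E → E ⊢ l ≈ r
      inst   : ∀ {σ} {t u : OTerm σ} (s : ∀ {τ} → Vars τ → OTerm τ) →
               E ⊢ t ≈ u → E ⊢ subst s t ≈ subst s u
      ctx    : (C : Con) {ts us : Args Vars (arity C)} →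
               E ⊢ ts ≈* us → E ⊢ app C ts ≈ app C us
      refl≈  : ∀ {σ} {t : OTerm σ} → E ⊢ t ≈ t
      sym≈   : ∀ {σ} {t u : OTerm σ} → E ⊢ t ≈ u → E ⊢ u ≈ t
      trans≈ : ∀ {σ} {t u v : OTerm σ} → E ⊢ t ≈ u → E ⊢ u ≈ v → E ⊢ t ≈ v

    data _⊢_≈*_ (E : List Equation) : ∀ {σs} → Args Vars σs → Args Vars σs → Set where
      []  : E ⊢ [] ≈* []
      _∷_ : ∀ {σ σs} {t u : OTerm σ} {ts us : Args Vars σs} →
            E ⊢ t ≈ u → E ⊢ ts ≈* us → E ⊢ (t ∷ ts) ≈* (u ∷ us)

  _⊢_=E_ : List Equation → ∀ {σ} → GTerm σ → GTerm σ → Set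
  E ⊢ t =E u = E ⊢ embed t ≈ embed u

  record ValidNormalization (E : List Equation) (f : GTerm π → GTerm π) : Set where
    field
      sound : ∀ t → E ⊢ f t =E t
      canon : ∀ t u → E ⊢ t =E u → f t ≡ f u

  ConstructionFunctions : Set
  ConstructionFunctions = (C : Con) → GArgs (arity C) → GTerm π

  mutual
    data IsVal (F : ConstructionFunctions) : ∀ {σ} → GTerm σ → Set where
      primVal : ∀ {s} (t : GTerm (prim s)) → IsVal F t
      conVal  : (C : Con) (vs : GArgs (arity C)) → AllVal F vs → IsVal F (F C vs)

    data AllVal (F : ConstructionFunctions) : ∀ {σs} → GArgs σs → Set where
      []  : AllVal F []
      _∷_ : ∀ {σ σs} {v : GTerm σ} {vs : GArgs σs} →
            IsVal F v → AllVal F vs → AllVal F (v ∷ vs)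

  record ValidConstruction (E : List Equation) (F : ConstructionFunctions) : Set where
    field
      correctness : (C : Con) (vs : GArgs (arity C)) → AllVal F vs →
                    E ⊢ F C vs =E app C vs
      completeness : (C : Con) (vs : GArgs (arity C)) → AllVal F vs →
                     (D : Con) (ws : GArgs (arity D)) → AllVal F ws →
                     E ⊢ app C vs =E app D ws → F C vs ≡ F D ws

{-# OPTIONS --safe #-}
module Submission where

open import Defs
open import Data.List using (List)

-- The value hypotheses are not needed: both properties hold for arbitrary argument tuples.
theorem2 : (Γ : DataType) (E : List (Equation Γ)) (f : GTerm Γ π → GTerm Γ π) →
           ValidNormalization Γ E f →
           ValidConstruction Γ E (λ C ts → f (app C ts))
theorem2 Γ E f normal = record
  { correctness  = λ C vs _ → sound (app C vs)
  ; completeness = λ C vs _ D ws _ → canon (app C vs) (app D ws)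
  }
  where open ValidNormalization normal
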